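{- Let $G=(A\cup B,E)$ with $|A|=|B|=n$, where each agent has a strict partial order over her neighbors, and let $F\subseteq E$ be a set of forbidden edges. Algorithm 2 (described in the context) outputs a popular assignment $M$ of $G$ with $M\cap F=\emptyset$, if such an assignment exists in $G$.
   Context: For $\ell:B\to\mathbb{N}$ and $a\in A$, $\ell^*(a)=\max_{b\in\mathsf{Nbr}(a)}\ell(b)$; $G_\ell=(A\cup B,E_\ell)$ contains $(a,b)\in E$ iff (i) $\ell(b)=\ell^*(a)$ and no neighbor $b'$ of $a$ with $\ell(b')=\ell^*(a)$ has $b'\succ_ab$; or (ii) $\ell(b)=\ell^*(a)-1$, $b\succ_ab'$ for all neighbors $b'$ of $a$ with $\ell(b')=\ell^*(a)$, and no neighbor $b''$ with $\ell(b'')=\ell^*(a)-1$ has $b''\succ_ab$. Algorithm 2: set $\ell(b)=0$ for all $b\in B$; while $\ell(b)<n$ for all $b\in B$: construct $G_\ell$ and compute a maximum matching $M$ in $G_\ell-F$ (edge set $E_\ell\setminus F$); if $M$ is perfect, return $M$; otherwise increase $\ell(b)$ by 1 for every $b\in B$ unmatched in $M$. If the loop ends, report that no popular assignment avoiding $F$ exists. Popularity: agent $a$ prefers matching $M$ to $N$ if matched in $M$ and either unmatched in $N$ or $M(a)\succ_aN(a)$; $\Delta(M,N)$ is the number preferring $M$ minus the number preferring $N$; a popular assignment is a perfect matching $M$ with $\Delta(M,N)\ge0$ for all perfect matchings $N$ of $G$. -}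

module Defs where

open import Data.Nat using (ℕ; zero; suc; _+_; _*_; _≤_; _<_; _⊔_; _<ᵇ_; _≡ᵇ_)
open import Data.Bool using (Bool; true; false; _∧_; _∨_; not; if_then_else_)
open import Data.Fin using (Fin)
open import Data.Fin.Properties renaming (_≟_ to _≟ᶠ_)
open import Data.List using (List; filter; length; allFin; foldr)
open import Data.Maybe using (Maybe; just; nothing; is-just)
open import Data.Product using (Σ; _×_; _,_; proj₁)
open import Relation.Binary.PropositionalEquality using (_≡_; _≢_)
open import Relation.Nullary using (¬_)
open import Relation.Nullary.Decidable using (⌊_⌋)

-- Instance: A = Fin n (agents), B = Fin n (items).
-- E a b        : (a,b) is an edge of G.
-- pref a b b'  : b ≻_a b'  (agent a strictly prefers b to b').

EdgeSet : ℕ → Set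
EdgeSet n = Fin n → Fin n → Bool

Prefs : ℕ → Set
Prefs n = Fin n → Fin n → Fin n → Bool

IsStrictPartialPrefs : ∀ {n} → EdgeSet n → Prefs n → Set
IsStrictPartialPrefs {n} E pref =
  (∀ a b → E a b ≡ true → pref a b b ≡ false)
  × (∀ a b c d → E a b ≡ true → E a c ≡ true → E a d ≡ true →
       pref a b c ≡ true → pref a c d ≡ true → pref a b d ≡ true)

_⊆ᴱ_ : ∀ {n} → EdgeSet n → EdgeSet n → Set
F ⊆ᴱ E = ∀ a b → F a b ≡ true → E a b ≡ true

-- Matchings: M a = just b means (a,b) ∈ M; nothing means a unmatched.

Matching : ℕ → Set
Matching n = Fin n → Maybe (Fin n)

IsMatchingIn : ∀ {n} → EdgeSet n → Matching n → Set
IsMatchingIn {n} H M =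
  (∀ a b → M a ≡ just b → H a b ≡ true)
  × (∀ a a' b → M a ≡ just b → M a' ≡ just b → a ≡ a')

size : ∀ {n} → Matching n → ℕ
size {n} M = length (filter (λ a → Data.Bool._≟_ (is-just (M a)) true) (allFin n))

IsMaximumMatching : ∀ {n} → EdgeSet n → Matching n → Set
IsMaximumMatching {n} H M =
  IsMatchingIn H M × (∀ N → IsMatchingIn H N → size N ≤ size M)

-- perfect (|A| = |B| = n): every agent is matched
IsPerfect : ∀ {n} → Matching n → Set
IsPerfect {n} M = ∀ a → is-just (M a) ≡ true

IsPerfectMatchingOf : ∀ {n} → EdgeSet n → Matching n → Set
IsPerfectMatchingOf H M = IsMatchingIn H M × IsPerfect M

Avoids : ∀ {n} → Matching n → EdgeSet n → Set
Avoids {n} M F = ∀ a b → M a ≡ just b → F a b ≡ false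

prefersᵇ : ∀ {n} → Prefs n → Fin n → Matching n → Matching n → Bool
prefersᵇ pref a M N with M a | N a
... | nothing | _ = false
... | just b | nothing = true
... | just b | just b' = pref a b b'

countPrefer : ∀ {n} → Prefs n → Matching n → Matching n → ℕ
countPrefer {n} pref M N =
  length (filter (λ a → Data.Bool._≟_ (prefersᵇ pref a M N) true) (allFin n))

ΔNonneg : ∀ {n} → Prefs n → Matching n → Matching n → Set
ΔNonneg pref M N = countPrefer pref N M ≤ countPrefer pref M N

IsPopular : ∀ {n} → EdgeSet n → Prefs n → Matching n → Set
IsPopular E pref M =
  IsPerfectMatchingOf E M
  × (∀ N → IsPerfectMatchingOf E N → ΔNonneg pref M N)

allB : ∀ {n} → (Fin n → Bool) → Bool
allB {n} p = foldr (λ x r → p x ∧ r) true (allFin n)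

-- ℓ*(a) = max over neighbours b of ℓ(b)  (0 if a has no neighbour;
-- irrelevant then, since a has no edge in G_ℓ)
ℓ* : ∀ {n} → EdgeSet n → (Fin n → ℕ) → Fin n → ℕ
ℓ* {n} E ℓ a = foldr (λ b r → (if E a b then ℓ b else 0) ⊔ r) 0 (allFin n)

Gℓ : ∀ {n} → EdgeSet n → Prefs n → (Fin n → ℕ) → EdgeSet n
Gℓ {n} E pref ℓ a b = E a b ∧ (cond-i ∨ cond-ii)
  where
  top : ℕ
  top = ℓ* E ℓ a
  cond-i : Bool
  cond-i = (ℓ b ≡ᵇ top)
    ∧ allB (λ b' → not (E a b' ∧ (ℓ b' ≡ᵇ top) ∧ pref a b' b))
  cond-ii : Bool
  cond-ii = (ℓ b + 1 ≡ᵇ top)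
    ∧ allB (λ b' → not (E a b' ∧ (ℓ b' ≡ᵇ top)) ∨ pref a b b')
    ∧ allB (λ b'' → not (E a b'' ∧ (ℓ b'' + 1 ≡ᵇ top) ∧ pref a b'' b))

minusF : ∀ {n} → EdgeSet n → EdgeSet n → EdgeSet n
minusF H F a b = H a b ∧ not (F a b)

-- Algorithm 2, parametrised by an arbitrary maximum-matching oracle
-- (the algorithm may use any maximum matching).

MaxMatchingOracle : ℕ → Set
MaxMatchingOracle n = (H : EdgeSet n) → Σ (Matching n) (IsMaximumMatching H)

perfectᵇ : ∀ {n} → Matching n → Bool
perfectᵇ M = allB (λ a → is-just (M a))

unmatchedᵇ : ∀ {n} → Matching n → Fin n → Bool
unmatchedᵇ M b = allB (λ a → not (matchesTo (M a)))
  where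
  matchesTo : Maybe _ → Bool
  matchesTo nothing = false
  matchesTo (just b') = ⌊ b' ≟ᶠ b ⌋

-- loop with fuel; `nothing` = "no popular assignment avoiding F exists".
-- Fuel n*n+1 suffices: each non-final iteration raises Σ ℓ by ≥ 1 and the
-- loop only runs while every ℓ(b) < n.
loop : ∀ {n} → EdgeSet n → Prefs n → EdgeSet n → MaxMatchingOracle n →
       ℕ → (Fin n → ℕ) → Maybe (Matching n)
loop E pref F mm zero ℓ = nothing
loop {n} E pref F mm (suc k) ℓ =
  if allB (λ b → ℓ b <ᵇ n)
  then (let M = proj₁ (mm (minusF (Gℓ E pref ℓ) F)) in
        if perfectᵇ M then just M
        else loop E pref F mm k (λ b → if unmatchedᵇ M b then suc (ℓ b) else ℓ b))
  else nothing

algorithm2 : ∀ {n} → EdgeSet n → Prefs n → EdgeSet n → MaxMatchingOracle n →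
             Maybe (Matching n)
algorithm2 {n} E pref F mm = loop E pref F mm (suc (n * n)) (λ _ → 0)

-- Soundness: if M is a perfect matching of G_ℓ, then for every agent a and every neighbour b
-- we have ℓ(b) + [b ≻_a M(a)] ≤ ℓ(M(a)) + [M(a) ≻_a b]. Summing this over the agents against any
-- perfect matching N, the level terms cancel (both matchings are bijections), which leaves
-- #{a prefers N} ≤ #{a prefers M}.
--
-- Completeness: let P be a popular assignment avoiding F. Moving agent a from P(a) to P(a′)
-- changes her vote by +1, 0 or −1; longest walks in this exchange graph, computed by a
-- Bellman–Ford iteration, give item levels d with d < n under which every edge of P is optimal,
-- because a walk that keeps rising for n rounds closes a cycle, and rotating P along it would
-- beat P. As long as ℓ ≤ d, an item b left unmatched by a maximum matching of G_ℓ − F has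
-- ℓ(b) < d(b): otherwise re-matching the items with ℓ = d along P gives a larger matching. So
-- the levels stay below n while Σ (d − ℓ) falls every round, and the algorithm must stop with a
-- perfect matching.
module Submission where

open import Defs
open import Data.Nat.Properties
open import Algebra.Properties.CommutativeMonoid.Sum +-0-commutativeMonoid
  using (sum; ∑-distrib-+; sum-permute; sum-cong-≗)
open import Data.Bool using (Bool; true; false; _∧_; _∨_; not; if_then_else_)
open import Data.Bool.Properties using (∧-conicalˡ; ∧-conicalʳ; T-≡; ¬-not; not-injective)
  renaming (_≟_ to _≟ᵇ_)
open import Data.Empty using (⊥; ⊥-elim)
open import Data.Fin using (Fin; zero; suc; toℕ; punchOut)
open import Data.Fin.Permutation using (permutation)
open import Data.Fin.Properties
  using (any?; punchOut-injective; injective⇒≤; ¬∀⟶∃¬; pigeonhole; toℕ≤pred[n])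
  renaming (_≟_ to _≟ᶠ_; suc-injective to suc-injectiveᶠ)
open import Data.List using (List; []; _∷_; length; filter; foldr; tabulate; allFin)
open import Data.List.Membership.Propositional using (_∈_)
open import Data.List.Membership.Propositional.Properties using (∈-allFin)
open import Data.List.Relation.Unary.Any using (here; there)
open import Data.Maybe using (Maybe; just; nothing; is-just; fromMaybe)
open import Data.Maybe.Properties using (just-injective)
open import Data.Nat
  using (ℕ; zero; suc; pred; _+_; _*_; _∸_; _≤_; _<_; _⊔_; _≡ᵇ_; _<ᵇ_; _≤′_; ≤′-refl; ≤′-step;
         z≤n; s≤s; s≤s⁻¹)
open import Data.Product using (Σ; ∃; _×_; _,_; proj₁; proj₂)
open import Data.Sum using (_⊎_; inj₁; inj₂)
open import Function using (_∘_; _∘′_; id; Equivalence)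
open import Relation.Binary using (tri<; tri≈; tri>)
open import Relation.Binary.PropositionalEquality
open import Relation.Nullary using (¬_; Dec; yes; no; contradiction)
open import Relation.Nullary.Decidable using (_×-dec_)

boolToℕ : Bool → ℕ
boolToℕ true = 1
boolToℕ false = 0

count : ∀ {n} → (Fin n → Bool) → ℕ
count q = sum (boolToℕ ∘ q)

length-filter-tabulate : ∀ {A : Set} {n} (q : A → Bool) (g : Fin n → A) →
  length (filter (λ x → q x ≟ᵇ true) (tabulate g)) ≡ count (q ∘ g)
length-filter-tabulate {n = zero} q g = refl
length-filter-tabulate {n = suc n} q g with q (g zero)
... | true = cong suc (length-filter-tabulate q (g ∘ suc))
... | false = length-filter-tabulate q (g ∘ suc)

length-filter-allFin : ∀ {n} (q : Fin n → Bool) →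
  length (filter (λ x → q x ≟ᵇ true) (allFin n)) ≡ count q
length-filter-allFin q = length-filter-tabulate q id

∑-mono-≤ : ∀ {n} {f g : Fin n → ℕ} → (∀ i → f i ≤ g i) → sum f ≤ sum g
∑-mono-≤ {zero} f≤g = z≤n
∑-mono-≤ {suc n} f≤g = +-mono-≤ (f≤g zero) (∑-mono-≤ (f≤g ∘ suc))

∑-mono-< : ∀ {n} {f g : Fin n → ℕ} → (∀ i → f i ≤ g i) → ∀ k → f k < g k → sum f < sum g
∑-mono-< f≤g zero fk<gk = +-mono-<-≤ fk<gk (∑-mono-≤ (f≤g ∘ suc))
∑-mono-< f≤g (suc k) fk<gk = +-mono-≤-< (f≤g zero) (∑-mono-< (f≤g ∘ suc) k fk<gk)

∑-≤-const : ∀ {n c} {f : Fin n → ℕ} → (∀ i → f i ≤ c) → sum f ≤ n * c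
∑-≤-const {zero} _ = z≤n
∑-≤-const {suc n} f≤c = +-mono-≤ (f≤c zero) (∑-≤-const (f≤c ∘ suc))

Injective : ∀ {m n} → (Fin m → Fin n) → Set
Injective σ = ∀ i j → σ i ≡ σ j → i ≡ j

-- If σ missed b, punching b out of its range would inject Fin (suc m) into Fin m.
injective⇒surjective : ∀ {n} {σ : Fin n → Fin n} → Injective σ → ∀ b → ∃ λ a → σ a ≡ b
injective⇒surjective {suc m} {σ} σ-inj b with any? (λ a → σ a ≟ᶠ b)
... | yes hit = hit
... | no miss = contradiction (injective⇒≤ punched-inj) (<-irrefl refl)
  where
  punched : Fin (suc m) → Fin m
  punched a = punchOut {i = b} {j = σ a} (λ e → miss (a , sym e))
  punched-inj : ∀ {i j} → punched i ≡ punched j → i ≡ j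
  punched-inj {i} {j} eq = σ-inj i j (punchOut-injective {i = b} _ _ eq)

∑-reindex : ∀ {n} {σ : Fin n → Fin n} → Injective σ → (u : Fin n → ℕ) → sum (u ∘ σ) ≡ sum u
∑-reindex {n} {σ} σ-inj u = sym (sum-permute u (permutation σ σ⁻¹ section retraction))
  where
  σ⁻¹ : Fin n → Fin n
  σ⁻¹ b = proj₁ (injective⇒surjective σ-inj b)
  section : ∀ b → σ (σ⁻¹ b) ≡ b
  section b = proj₂ (injective⇒surjective σ-inj b)
  retraction : ∀ a → σ⁻¹ (σ a) ≡ a
  retraction a = σ-inj _ _ (section (σ a))

∑-reindex-+ : ∀ {n} {σ : Fin n → Fin n} → Injective σ → (u f : Fin n → ℕ) →
  sum (λ i → u (σ i) + f i) ≡ sum u + sum f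
∑-reindex-+ {σ = σ} σ-inj u f = trans (∑-distrib-+ (u ∘ σ) f) (cong (_+ sum f) (∑-reindex σ-inj u))

module _ {n} {σ τ : Fin n → Fin n} (σ-inj : Injective σ) (τ-inj : Injective τ)
         (u f g : Fin n → ℕ) where

  private
    reindexed : ∀ {_R_ : ℕ → ℕ → Set} →
      sum (λ i → u (σ i) + f i) R sum (λ i → u (τ i) + g i) → (sum u + sum f) R (sum u + sum g)
    reindexed {_R_} = subst₂ _R_ (∑-reindex-+ σ-inj u f) (∑-reindex-+ τ-inj u g)

  ∑-≤-by-potential : (∀ i → u (σ i) + f i ≤ u (τ i) + g i) → sum f ≤ sum g
  ∑-≤-by-potential le = +-cancelˡ-≤ (sum u) _ _ (reindexed {_≤_} (∑-mono-≤ le))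

  ∑-<-by-potential : (∀ i → u (σ i) + f i ≤ u (τ i) + g i) →
    ∀ k → u (σ k) + f k < u (τ k) + g k → sum f < sum g
  ∑-<-by-potential le k lt = +-cancelˡ-< (sum u) _ _ (reindexed {_<_} (∑-mono-< le k lt))

_∖_ : ∀ {n} → (Fin n → Bool) → Fin n → Fin n → Bool
(R ∖ zero) zero = false
(R ∖ zero) (suc j) = R (suc j)
(R ∖ suc k) zero = R zero
(R ∖ suc k) (suc j) = ((R ∘ suc) ∖ k) j

∖-other : ∀ {n} (R : Fin n → Bool) {j k} → j ≢ k → (R ∖ k) j ≡ R j
∖-other R {zero} {zero} j≢k = contradiction refl j≢k
∖-other R {zero} {suc k} j≢k = refl
∖-other R {suc j} {zero} j≢k = refl
∖-other R {suc j} {suc k} j≢k = ∖-other (R ∘ suc) (j≢k ∘ cong suc)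

count-∖ : ∀ {n} (R : Fin n → Bool) k → R k ≡ true → count R ≡ suc (count (R ∖ k))
count-∖ R zero Rk rewrite Rk = refl
count-∖ R (suc k) Rk = trans (cong (boolToℕ (R zero) +_) (count-∖ (R ∘ suc) k Rk)) (+-suc _ _)

InjectiveOn : ∀ {m n} → (Fin m → Bool) → (Fin m → Fin n) → Set
InjectiveOn Q g = ∀ i j → Q i ≡ true → Q j ≡ true → g i ≡ g j → i ≡ j

injectiveOn-tail : ∀ {m n} {Q : Fin (suc m) → Bool} {g : Fin (suc m) → Fin n} →
  InjectiveOn Q g → InjectiveOn (Q ∘ suc) (g ∘ suc)
injectiveOn-tail inj i j Qi Qj eq = suc-injectiveᶠ (inj (suc i) (suc j) Qi Qj eq)

count-≤-injection : ∀ {m n} (Q : Fin m → Bool) (R : Fin n → Bool) (g : Fin m → Fin n) →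
  (∀ i → Q i ≡ true → R (g i) ≡ true) → InjectiveOn Q g → count Q ≤ count R
count-≤-injection {zero} Q R g into inj = z≤n
count-≤-injection {suc m} Q R g into inj with Q zero in Q0
... | false = count-≤-injection (Q ∘ suc) R (g ∘ suc) (into ∘ suc) (injectiveOn-tail inj)
... | true = subst (suc (count (Q ∘ suc)) ≤_) (sym (count-∖ R (g zero) (into zero Q0)))
    (s≤s (count-≤-injection (Q ∘ suc) (R ∖ g zero) (g ∘ suc) into′ (injectiveOn-tail inj)))
  where
  into′ : ∀ i → Q (suc i) ≡ true → (R ∖ g zero) (g (suc i)) ≡ true
  into′ i Qi = trans (∖-other R λ e → contradiction (inj zero (suc i) Q0 Qi (sym e)) λ ())
                     (into (suc i) Qi)

count-<-injection : ∀ {m n} (Q : Fin m → Bool) (R : Fin n → Bool) (g : Fin m → Fin n) →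
  (∀ i → Q i ≡ true → R (g i) ≡ true) → InjectiveOn Q g →
  ∀ k → R k ≡ true → (∀ i → Q i ≡ true → g i ≢ k) → count Q < count R
count-<-injection Q R g into inj k Rk miss = subst (count Q <_) (sym (count-∖ R k Rk))
  (s≤s (count-≤-injection Q (R ∖ k) g (λ i Qi → trans (∖-other R (miss i Qi)) (into i Qi)) inj))

least : ∀ {Q : ℕ → Set} → (∀ k → Dec (Q k)) → ∀ {k} → Q k →
  ∃ λ J → J ≤ k × Q J × (∀ {j} → j < J → ¬ Q j)
least {Q} Q? {k} Qk = search k (k , ≤-refl , Qk)
  where
  search : ∀ k → (∃ λ j → j ≤ k × Q j) → ∃ λ J → J ≤ k × Q J × (∀ {j} → j < J → ¬ Q j)
  search zero (zero , _ , Q0) = zero , z≤n , Q0 , λ ()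
  search (suc k) (j , j≤1+k , Qj) with anyUpTo? Q? (suc k)
  ... | yes (i , i<1+k , Qi) with J , J≤k , QJ , minimal ← search k (i , s≤s⁻¹ i<1+k , Qi) =
    J , m≤n⇒m≤1+n J≤k , QJ , minimal
  ... | no none with m≤n⇒m<n∨m≡n j≤1+k
  ...   | inj₁ j<1+k = contradiction (j , j<1+k , Qj) none
  ...   | inj₂ refl = suc k , ≤-refl , Qj , λ {i} i<1+k Qi → none (i , i<1+k , Qi)

module _ {A : Set} (p : A → Bool) where

  all-foldr⁻ : ∀ xs → foldr (λ x r → p x ∧ r) true xs ≡ true → ∀ {x} → x ∈ xs → p x ≡ true
  all-foldr⁻ (y ∷ xs) all (here refl) = ∧-conicalˡ _ _ all
  all-foldr⁻ (y ∷ xs) all (there x∈xs) = all-foldr⁻ xs (∧-conicalʳ _ _ all) x∈xs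

  all-foldr⁺ : ∀ xs → (∀ {x} → x ∈ xs → p x ≡ true) → foldr (λ x r → p x ∧ r) true xs ≡ true
  all-foldr⁺ [] _ = refl
  all-foldr⁺ (y ∷ xs) all rewrite all (here refl) = all-foldr⁺ xs (all ∘′ there)

allB⁻ : ∀ {n} {p : Fin n → Bool} → allB p ≡ true → ∀ x → p x ≡ true
allB⁻ {n} {p} all x = all-foldr⁻ p (allFin n) all (∈-allFin x)

allB⁺ : ∀ {n} {p : Fin n → Bool} → (∀ x → p x ≡ true) → allB p ≡ true
allB⁺ {n} {p} all = all-foldr⁺ p (allFin n) (λ {x} _ → all x)

allB-false : ∀ {n} {p : Fin n → Bool} → allB p ≡ false → ∃ λ x → p x ≡ false
allB-false {n} {p} none with ¬∀⟶∃¬ n (λ x → p x ≡ true) (λ x → p x ≟ᵇ true)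
                                  (λ all → contradiction (trans (sym none) (allB⁺ all)) λ ())
... | x , px≢true = x , ¬-not px≢true

module _ {A : Set} (f : A → ℕ) where

  maxOver : List A → ℕ
  maxOver = foldr (λ x r → f x ⊔ r) 0

  ≤-maxOver : ∀ {xs x} → x ∈ xs → f x ≤ maxOver xs
  ≤-maxOver {y ∷ xs} (here refl) = m≤m⊔n (f y) _
  ≤-maxOver {y ∷ xs} (there x∈xs) = ≤-trans (≤-maxOver x∈xs) (m≤n⊔m (f y) _)

  maxOver-lub : ∀ {xs c} → (∀ {x} → x ∈ xs → f x ≤ c) → maxOver xs ≤ c
  maxOver-lub {[]} _ = z≤n
  maxOver-lub {y ∷ xs} bound = ⊔-lub (bound (here refl)) (maxOver-lub (bound ∘′ there))

  maxOver-attained : ∀ xs → maxOver xs ≡ 0 ⊎ ∃ λ x → x ∈ xs × f x ≡ maxOver xs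
  maxOver-attained [] = inj₁ refl
  maxOver-attained (y ∷ xs) with ⊔-sel (f y) (maxOver xs)
  ... | inj₁ head = inj₂ (y , here refl , sym head)
  ... | inj₂ tail with maxOver-attained xs
  ...   | inj₁ isZero = inj₁ (trans tail isZero)
  ...   | inj₂ (x , x∈xs , fx) = inj₂ (x , there x∈xs , trans fx (sym tail))

≡ᵇ-true⁻ : ∀ {m n} → (m ≡ᵇ n) ≡ true → m ≡ n
≡ᵇ-true⁻ {m} {n} e = ≡ᵇ⇒≡ m n (Equivalence.from T-≡ e)

≡ᵇ-true⁺ : ∀ {m n} → m ≡ n → (m ≡ᵇ n) ≡ true
≡ᵇ-true⁺ {m} {n} e = Equivalence.to T-≡ (≡⇒≡ᵇ m n e)

∧-intro : ∀ {x y} → x ≡ true → y ≡ true → x ∧ y ≡ true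
∧-intro refl refl = refl

∨-true : ∀ {x y} → x ∨ y ≡ true → x ≡ true ⊎ y ≡ true
∨-true {true} _ = inj₁ refl
∨-true {false} y = inj₂ y

∨-introˡ : ∀ {x y} → x ≡ true → x ∨ y ≡ true
∨-introˡ refl = refl

∨-introʳ : ∀ {x y} → y ≡ true → x ∨ y ≡ true
∨-introʳ {true} _ = refl
∨-introʳ {false} y = y

not∧∧⁺ : ∀ {x y z} → (x ≡ true → y ≡ true → z ≡ true → ⊥) → not (x ∧ y ∧ z) ≡ true
not∧∧⁺ {true} {true} {true} never = ⊥-elim (never refl refl refl)
not∧∧⁺ {true} {true} {false} _ = refl
not∧∧⁺ {true} {false} _ = refl
not∧∧⁺ {false} _ = refl

not∧∧⁻ : ∀ {x y z} → not (x ∧ y ∧ z) ≡ true → x ≡ true → y ≡ true → z ≡ true → ⊥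
not∧∧⁻ () refl refl refl

not∧∨⁺ : ∀ {x y z} → (x ≡ true → y ≡ true → z ≡ true) → not (x ∧ y) ∨ z ≡ true
not∧∨⁺ {true} {true} imp = imp refl refl
not∧∨⁺ {true} {false} _ = refl
not∧∨⁺ {false} _ = refl

not∧∨⁻ : ∀ {x y z} → not (x ∧ y) ∨ z ≡ true → x ≡ true → y ≡ true → z ≡ true
not∧∨⁻ imp refl refl = imp

-- Levels and the graph G_ℓ

score-≤⁺ : ∀ {x y} p q → (p ≡ true → suc x ≤ y) → (q ≡ false → x ≤ y) → x ≤ suc y →
  x + boolToℕ p ≤ y + boolToℕ q
score-≤⁺ {x} {y} true true lt _ _ = +-monoˡ-≤ 1 (<⇒≤ (lt refl))
score-≤⁺ {x} {y} true false lt _ _ rewrite +-comm x 1 | +-identityʳ y = lt refl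
score-≤⁺ {x} {y} false true _ _ le rewrite +-identityʳ x | +-comm y 1 = le
score-≤⁺ {x} {y} false false _ le _ rewrite +-identityʳ x | +-identityʳ y = le refl

score-≤⁻ : ∀ {x y} p q → x + boolToℕ p ≤ y + boolToℕ q → (p ≡ true → q ≡ false) →
  (p ≡ true → suc x ≤ y) × (q ≡ false → x ≤ y) × x ≤ suc y
score-≤⁻ {x} {y} true true _ asym with () ← asym refl
score-≤⁻ {x} {y} true false le _ with lt ← subst₂ _≤_ (+-comm x 1) (+-identityʳ y) le =
  (λ _ → lt) , (λ _ → <⇒≤ lt) , ≤-trans (<⇒≤ lt) (n≤1+n y)
score-≤⁻ {x} {y} false true le _ with le′ ← subst₂ _≤_ (+-identityʳ x) (+-comm y 1) le =
  (λ ()) , (λ ()) , le′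
score-≤⁻ {x} {y} false false le _ with le′ ← subst₂ _≤_ (+-identityʳ x) (+-identityʳ y) le =
  (λ ()) , (λ _ → le′) , ≤-trans le′ (n≤1+n y)

module _ {n} (E : EdgeSet n) (pref : Prefs n) where

  -- The arithmetic form of the edge condition of G_ℓ: see optimal⇒Gℓ and Gℓ⇒optimal.
  Optimal : (Fin n → ℕ) → Fin n → Fin n → Set
  Optimal ℓ a b = ∀ b′ → E a b′ ≡ true → ℓ b′ + boolToℕ (pref a b′ b) ≤ ℓ b + boolToℕ (pref a b b′)

  pref-asym : IsStrictPartialPrefs E pref → ∀ {a b c} → E a b ≡ true → E a c ≡ true →
    pref a b c ≡ true → pref a c b ≡ false
  pref-asym (irrefl , trans′) {a} {b} {c} ab ac b≻c with pref a c b in c≻b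
  ... | false = refl
  ... | true with () ← trans (sym (trans′ a b c b ab ac ab b≻c c≻b)) (irrefl a b ab)

  module _ (ℓ : Fin n → ℕ) {a : Fin n} where

    ℓ*-ub : ∀ {b} → E a b ≡ true → ℓ b ≤ ℓ* E ℓ a
    ℓ*-ub {b} ab = subst (_≤ ℓ* E ℓ a) (cong (λ e → if e then ℓ b else 0) ab)
      (≤-maxOver (λ b → if E a b then ℓ b else 0) (∈-allFin b))

    ℓ*-attained : ∀ {b} → E a b ≡ true → ∃ λ b* → E a b* ≡ true × ℓ b* ≡ ℓ* E ℓ a
    ℓ*-attained {b} ab with maxOver-attained (λ b → if E a b then ℓ b else 0) (allFin n)
    ... | inj₁ top≡0 = b , ab , trans (n≤0⇒n≡0 (subst (ℓ b ≤_) top≡0 (ℓ*-ub ab))) (sym top≡0)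
    ... | inj₂ (b* , _ , attained) with E a b* in ab*
    ...   | true = b* , ab* , attained
    ...   | false = b , ab , ≤-antisym (ℓ*-ub ab) (subst (_≤ ℓ b) attained z≤n)

  module _ (po : IsStrictPartialPrefs E pref) (ℓ : Fin n → ℕ) {a b : Fin n} where

    private
      top : ℕ
      top = ℓ* E ℓ a

      ℓb+1≡1+ℓb : ℓ b + 1 ≡ suc (ℓ b)
      ℓb+1≡1+ℓb = +-comm (ℓ b) 1

      noBetterAtTop noBetterBelow beatsAtTop : Fin n → Bool
      noBetterAtTop b′ = not (E a b′ ∧ (ℓ b′ ≡ᵇ top) ∧ pref a b′ b)
      noBetterBelow b′ = not (E a b′ ∧ (ℓ b′ + 1 ≡ᵇ top) ∧ pref a b′ b)
      beatsAtTop b′ = not (E a b′ ∧ (ℓ b′ ≡ᵇ top)) ∨ pref a b b′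

    optimal⇒Gℓ : E a b ≡ true → Optimal ℓ a b → Gℓ E pref ℓ a b ≡ true
    optimal⇒Gℓ ab opt with m≤n⇒m<n∨m≡n (ℓ*-ub ℓ ab)
    ... | inj₂ ℓb≡top = ∧-intro ab (∨-introˡ (∧-intro (≡ᵇ-true⁺ ℓb≡top)
          (allB⁺ {p = noBetterAtTop} λ b′ → not∧∧⁺ λ ab′ b′-top b′≻b →
             <-irrefl (trans (≡ᵇ-true⁻ b′-top) (sym ℓb≡top)) (better ab′ b′≻b))))
      where
      better : ∀ {b′} → E a b′ ≡ true → pref a b′ b ≡ true → suc (ℓ b′) ≤ ℓ b
      better ab′ = proj₁ (score-≤⁻ _ _ (opt _ ab′) (pref-asym po ab′ ab))
    ... | inj₁ ℓb<top = ∧-intro ab (∨-introʳ (∧-intro (≡ᵇ-true⁺ (trans ℓb+1≡1+ℓb (sym top≡)))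
          (∧-intro (allB⁺ {p = beatsAtTop} λ b′ → not∧∨⁺ λ ab′ b′-top → ¬-not λ b⊁b′ →
                      <-irrefl (trans (≡ᵇ-true⁻ b′-top) top≡) (s≤s (proj₁ (proj₂ (facts ab′)) b⊁b′)))
                   (allB⁺ {p = noBetterBelow} λ b″ → not∧∧⁺ λ ab″ b″-below b″≻b →
                      <-irrefl (suc-injective (trans (+-comm 1 (ℓ b″)) (trans (≡ᵇ-true⁻ b″-below) top≡)))
                               (proj₁ (facts ab″) b″≻b)))))
      where
      facts : ∀ {b′} → E a b′ ≡ true →
        (pref a b′ b ≡ true → suc (ℓ b′) ≤ ℓ b) × (pref a b b′ ≡ false → ℓ b′ ≤ ℓ b)
        × ℓ b′ ≤ suc (ℓ b)
      facts ab′ = score-≤⁻ _ _ (opt _ ab′) (pref-asym po ab′ ab)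
      top≡ : top ≡ suc (ℓ b)
      top≡ with b* , ab* , ℓb*≡top ← ℓ*-attained ℓ ab =
        ≤-antisym (subst (_≤ suc (ℓ b)) ℓb*≡top (proj₂ (proj₂ (facts ab*)))) ℓb<top

    Gℓ⇒optimal : Gℓ E pref ℓ a b ≡ true → Optimal ℓ a b
    Gℓ⇒optimal g b′ ab′ with ∨-true (∧-conicalʳ _ _ g)
    ... | inj₁ cond-i = score-≤⁺ _ _
          (λ b′≻b → ≤∧≢⇒< ℓb′≤ℓb λ ℓb′≡ℓb →
             not∧∧⁻ (allB⁻ {p = noBetterAtTop} (∧-conicalʳ _ _ cond-i) b′) ab′
               (≡ᵇ-true⁺ (trans ℓb′≡ℓb ℓb≡top)) b′≻b)
          (λ _ → ℓb′≤ℓb) (≤-trans ℓb′≤ℓb (n≤1+n _))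
      where
      ℓb≡top : ℓ b ≡ top
      ℓb≡top = ≡ᵇ-true⁻ (∧-conicalˡ _ _ cond-i)
      ℓb′≤ℓb : ℓ b′ ≤ ℓ b
      ℓb′≤ℓb = subst (ℓ b′ ≤_) (sym ℓb≡top) (ℓ*-ub ℓ ab′)
    ... | inj₂ cond-ii = score-≤⁺ _ _ b′≻b⇒below b⊁b′⇒ℓb′≤ℓb ℓb′≤1+ℓb
      where
      top≡ : top ≡ suc (ℓ b)
      top≡ = trans (sym (≡ᵇ-true⁻ (∧-conicalˡ _ _ cond-ii))) ℓb+1≡1+ℓb
      rest : allB beatsAtTop ∧ allB noBetterBelow ≡ true
      rest = ∧-conicalʳ (ℓ b + 1 ≡ᵇ top) _ cond-ii
      ℓb′≤1+ℓb : ℓ b′ ≤ suc (ℓ b)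
      ℓb′≤1+ℓb = subst (ℓ b′ ≤_) top≡ (ℓ*-ub ℓ ab′)
      at-top⇒b≻b′ : ℓ b′ ≡ suc (ℓ b) → pref a b b′ ≡ true
      at-top⇒b≻b′ ℓb′≡top = not∧∨⁻ (allB⁻ {p = beatsAtTop} (∧-conicalˡ _ _ rest) b′)
        ab′ (≡ᵇ-true⁺ (trans ℓb′≡top (sym top≡)))
      b⊁b′⇒ℓb′≤ℓb : pref a b b′ ≡ false → ℓ b′ ≤ ℓ b
      b⊁b′⇒ℓb′≤ℓb b⊁b′ with m≤n⇒m<n∨m≡n ℓb′≤1+ℓb
      ... | inj₁ ℓb′<1+ℓb = s≤s⁻¹ ℓb′<1+ℓb
      ... | inj₂ ℓb′≡top with () ← trans (sym (at-top⇒b≻b′ ℓb′≡top)) b⊁b′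
      b′≻b⇒below : pref a b′ b ≡ true → suc (ℓ b′) ≤ ℓ b
      b′≻b⇒below b′≻b = ≤∧≢⇒< (b⊁b′⇒ℓb′≤ℓb (pref-asym po ab′ (∧-conicalˡ _ _ g) b′≻b)) λ ℓb′≡ℓb →
        not∧∧⁻ (allB⁻ {p = noBetterBelow} (∧-conicalʳ _ _ rest) b′) ab′
          (≡ᵇ-true⁺ (trans (cong (_+ 1) ℓb′≡ℓb) (trans ℓb+1≡1+ℓb (sym top≡)))) b′≻b

size≡count : ∀ {n} (M : Matching n) → size M ≡ count (λ a → is-just (M a))
size≡count M = length-filter-allFin (λ a → is-just (M a))

countPrefer-assignments : ∀ {n} (pref : Prefs n) {M N : Matching n} {μ ν : Fin n → Fin n} →
  (∀ a → M a ≡ just (μ a)) → (∀ a → N a ≡ just (ν a)) →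
  countPrefer pref M N ≡ sum (λ a → boolToℕ (pref a (μ a) (ν a)))
countPrefer-assignments pref {M} {N} M≡μ N≡ν =
  trans (length-filter-allFin (λ a → prefersᵇ pref a M N)) (sum-cong-≗ (cong boolToℕ ∘ prefers))
  where
  prefers : ∀ a → prefersᵇ pref a M N ≡ pref a _ _
  prefers a rewrite M≡μ a | N≡ν a = refl

fromJust : ∀ {A : Set} (m : Maybe A) → is-just m ≡ true → A
fromJust (just x) _ = x

module Perfect {n} {H : EdgeSet n} {M : Matching n} (perfect : IsPerfectMatchingOf H M) where

  mate : Fin n → Fin n
  mate a = fromJust (M a) (proj₂ perfect a)

  M≡mate : ∀ a → M a ≡ just (mate a)
  M≡mate a with M a | proj₂ perfect a
  ... | just b | _ = refl

  mate-injective : Injective mate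
  mate-injective a a′ eq =
    proj₂ (proj₁ perfect) a a′ (mate a) (M≡mate a) (trans (M≡mate a′) (cong just (sym eq)))

  mate-edge : ∀ a → H a (mate a) ≡ true
  mate-edge a = proj₁ (proj₁ perfect) a (mate a) (M≡mate a)

-- Summing the Optimal inequalities of all agents against their N-partners, the levels cancel.
optimal⇒popular : ∀ {n} {E : EdgeSet n} {pref : Prefs n} {M : Matching n} (ℓ : Fin n → ℕ) →
  IsPerfectMatchingOf E M → (∀ a b → M a ≡ just b → Optimal E pref ℓ a b) → IsPopular E pref M
optimal⇒popular {E = E} {pref} {M} ℓ perfectM optimal = perfectM , undefeated
  where
  module M = Perfect perfectM
  undefeated : ∀ N → IsPerfectMatchingOf E N → ΔNonneg pref M N
  undefeated N perfectN =
    subst₂ _≤_ (sym (countPrefer-assignments pref N.M≡mate M.M≡mate))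
               (sym (countPrefer-assignments pref M.M≡mate N.M≡mate))
      (∑-≤-by-potential N.mate-injective M.mate-injective ℓ _ _ λ a →
         optimal a (M.mate a) (M.M≡mate a) (N.mate a) (N.mate-edge a))
    where module N = Perfect perfectN

-- Soundness of Algorithm 2

module _ {n} (E : EdgeSet n) (pref : Prefs n) (F : EdgeSet n) (mm : MaxMatchingOracle n) where

  oracle : (Fin n → ℕ) → Matching n
  oracle ℓ = proj₁ (mm (minusF (Gℓ E pref ℓ) F))

  loop-returns-oracle : ∀ k ℓ {M} → loop E pref F mm k ℓ ≡ just M →
    ∃ λ ℓ′ → oracle ℓ′ ≡ M × perfectᵇ M ≡ true
  loop-returns-oracle zero ℓ ()
  loop-returns-oracle (suc k) ℓ returns
    with allB (λ b → ℓ b <ᵇ n) | perfectᵇ (oracle ℓ) in perfect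
  ... | true | true =
    ℓ , just-injective returns , subst (λ M → perfectᵇ M ≡ true) (just-injective returns) perfect
  ... | true | false = loop-returns-oracle k _ returns
  ... | false | _ with () ← returns

  algorithm2-sound : IsStrictPartialPrefs E pref → ∀ M → algorithm2 E pref F mm ≡ just M →
    IsPopular E pref M × Avoids M F
  algorithm2-sound po M returns with loop-returns-oracle (suc (n * n)) (λ _ → 0) returns
  ... | ℓ , refl , perfect =
    optimal⇒popular ℓ ((inE , proj₂ matching) , allB⁻ perfect) optimal , avoids
    where
    matching : IsMatchingIn (minusF (Gℓ E pref ℓ) F) (oracle ℓ)
    matching = proj₁ (proj₂ (mm (minusF (Gℓ E pref ℓ) F)))
    inGℓ : ∀ a b → oracle ℓ a ≡ just b → Gℓ E pref ℓ a b ≡ true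
    inGℓ a b ab = ∧-conicalˡ _ _ (proj₁ matching a b ab)
    inE : ∀ a b → oracle ℓ a ≡ just b → E a b ≡ true
    inE a b ab = ∧-conicalˡ _ _ (inGℓ a b ab)
    optimal : ∀ a b → oracle ℓ a ≡ just b → Optimal E pref ℓ a b
    optimal a b ab = Gℓ⇒optimal E pref po ℓ (inGℓ a b ab)
    avoids : Avoids (oracle ℓ) F
    avoids a b ab = not-injective (∧-conicalʳ _ _ (proj₁ matching a b ab))

-- Completeness of Algorithm 2, given levels under which P is optimal

module _ {n} (M : Matching n) where

  unmatched⁻ : ∀ {b} → unmatchedᵇ M b ≡ true → ∀ a → M a ≢ just b
  unmatched⁻ {b} unmatched a Ma≡b with allB⁻ unmatched a
  ... | free rewrite Ma≡b with b ≟ᶠ b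
  ...   | yes _ with () ← free
  ...   | no b≢b = b≢b refl

  matched⁻ : ∀ {b} → unmatchedᵇ M b ≡ false → ∃ λ a → M a ≡ just b
  matched⁻ {b} matched with allB-false matched
  ... | a , taken with M a in Ma
  ...   | just b′ with b′ ≟ᶠ b
  ...     | yes refl = a , Ma

  -- Owners of distinct items are distinct agents, so the owners are all the agents.
  items-matched⇒perfect : (∀ b → ∃ λ a → M a ≡ just b) → IsPerfect M
  items-matched⇒perfect owned a =
    cong is-just (subst (λ a → M a ≡ just b) owner-b≡a (proj₂ (owned b)))
    where
    owner-injective : Injective (λ b → proj₁ (owned b))
    owner-injective b b′ eq =
      just-injective (trans (sym (proj₂ (owned b))) (trans (cong M eq) (proj₂ (owned b′))))
    b : Fin n
    b = proj₁ (injective⇒surjective owner-injective a)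
    owner-b≡a : proj₁ (owned b) ≡ a
    owner-b≡a = proj₂ (injective⇒surjective owner-injective a)

  unmatched-item : perfectᵇ M ≡ false → ∃ λ b → unmatchedᵇ M b ≡ true
  unmatched-item notPerfect with any? (λ b → unmatchedᵇ M b ≟ᵇ true)
  ... | yes found = found
  ... | no none with a₀ , a₀-free ← allB-false notPerfect
    with () ← trans (sym a₀-free)
                (items-matched⇒perfect (λ b → matched⁻ (¬-not λ free → none (b , free))) a₀)

matchedTo : ∀ {n} → (Fin n → Bool) → Maybe (Fin n) → Bool
matchedTo T nothing = false
matchedTo T (just b) = T b

is-just-split : ∀ {n} (T : Fin n → Bool) m →
  boolToℕ (is-just m) ≡ boolToℕ (matchedTo T m) + boolToℕ (matchedTo (not ∘ T) m)
is-just-split T nothing = refl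
is-just-split T (just b) with T b
... | true = refl
... | false = refl

module Completeness {n} {E : EdgeSet n} {pref : Prefs n} {F : EdgeSet n}
  (po : IsStrictPartialPrefs E pref) {P : Matching n} (perfectP : IsPerfectMatchingOf E P)
  (avoidsP : Avoids P F) (d : Fin n → ℕ)
  (d-optimal : ∀ a → Optimal E pref d a (Perfect.mate perfectP a))
  where

  open Perfect perfectP
    renaming (mate to p; M≡mate to P≡p; mate-injective to p-injective; mate-edge to p-edge)

  module _ (ℓ : Fin n → ℕ) (ℓ≤d : ∀ b → ℓ b ≤ d b) {M : Matching n}
           (maximum : IsMaximumMatching (minusF (Gℓ E pref ℓ) F) M) where

    private
      H : EdgeSet n
      H = minusF (Gℓ E pref ℓ) F
      M-edge : ∀ {a b} → M a ≡ just b → H a b ≡ true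
      M-edge = proj₁ (proj₁ maximum) _ _
      M-injective : ∀ {a a′ b} → M a ≡ just b → M a′ ≡ just b → a ≡ a′
      M-injective = proj₂ (proj₁ maximum) _ _ _

    tight : Fin n → Bool
    tight b = ℓ b ≡ᵇ d b

    P-edge-at-tight : ∀ {a} → tight (p a) ≡ true → H a (p a) ≡ true
    P-edge-at-tight {a} t = ∧-intro (optimal⇒Gℓ E pref po ℓ (p-edge a) optimal)
                                    (cong not (avoidsP a (p a) (P≡p a)))
      where
      optimal : Optimal E pref ℓ a (p a)
      optimal b ab = begin
        ℓ b + boolToℕ (pref a b (p a))      ≤⟨ +-monoˡ-≤ _ (ℓ≤d b) ⟩
        d b + boolToℕ (pref a b (p a))      ≤⟨ d-optimal a b ab ⟩
        d (p a) + boolToℕ (pref a (p a) b)  ≡⟨ cong (_+ boolToℕ (pref a (p a) b)) (≡ᵇ-true⁻ t) ⟨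
        ℓ (p a) + boolToℕ (pref a (p a) b)  ∎
        where open ≤-Reasoning

    partner-tight : ∀ {a b} → tight (p a) ≡ true → M a ≡ just b → tight b ≡ true
    partner-tight {a} {b} t Ma≡b = ≡ᵇ-true⁺ (≤-antisym (ℓ≤d b) (+-cancelʳ-≤ _ _ _ (begin
      d b + boolToℕ (pref a b (p a))      ≤⟨ d-optimal a b (∧-conicalˡ _ _ inGℓ) ⟩
      d (p a) + boolToℕ (pref a (p a) b)  ≡⟨ cong (_+ boolToℕ (pref a (p a) b)) (≡ᵇ-true⁻ t) ⟨
      ℓ (p a) + boolToℕ (pref a (p a) b)  ≤⟨ Gℓ⇒optimal E pref po ℓ inGℓ (p a) (p-edge a) ⟩
      ℓ b + boolToℕ (pref a b (p a))      ∎)))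
      where
      open ≤-Reasoning
      inGℓ : Gℓ E pref ℓ a b ≡ true
      inGℓ = ∧-conicalˡ _ _ (M-edge Ma≡b)

    -- Agents whose P-partner is tight take it; the others keep their non-tight M-partner.
    exchange : Bool → Fin n → Maybe (Fin n) → Maybe (Fin n)
    exchange true b _ = just b
    exchange false _ nothing = nothing
    exchange false _ (just c) = if tight c then nothing else just c

    N : Matching n
    N a = exchange (tight (p a)) (p a) (M a)

    N-cases : ∀ {a b} → N a ≡ just b →
      (tight (p a) ≡ true × p a ≡ b) ⊎ (M a ≡ just b × tight b ≡ false)
    N-cases {a} Na≡b with tight (p a) | M a
    ... | true | _ = inj₁ (refl , just-injective Na≡b)
    ... | false | just c with tight c in tc
    ...   | false = inj₂ (cong just (just-injective Na≡b) ,
                          subst (λ c → tight c ≡ false) (just-injective Na≡b) tc)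

    N-matching : IsMatchingIn H N
    N-matching = edge , injective
      where
      edge : ∀ a b → N a ≡ just b → H a b ≡ true
      edge a b Na≡b with N-cases Na≡b
      ... | inj₁ (t , refl) = P-edge-at-tight t
      ... | inj₂ (Ma≡b , _) = M-edge Ma≡b
      injective : ∀ a a′ b → N a ≡ just b → N a′ ≡ just b → a ≡ a′
      injective a a′ b Na≡b Na′≡b with N-cases Na≡b | N-cases Na′≡b
      ... | inj₁ (_ , pa≡b) | inj₁ (_ , pa′≡b) = p-injective a a′ (trans pa≡b (sym pa′≡b))
      ... | inj₂ (Ma≡b , _) | inj₂ (Ma′≡b , _) = M-injective Ma≡b Ma′≡b
      ... | inj₁ (t , refl) | inj₂ (_ , f) with () ← trans (sym t) f
      ... | inj₂ (_ , f) | inj₁ (t , refl) with () ← trans (sym t) f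

    N-count : ∀ a → boolToℕ (is-just (N a))
                    ≡ boolToℕ (tight (p a)) + boolToℕ (matchedTo (not ∘ tight) (M a))
    N-count a with tight (p a) in t | M a in Ma
    ... | true | nothing = refl
    ... | true | just c rewrite partner-tight t Ma = refl
    ... | false | nothing = refl
    ... | false | just c with tight c
    ...   | true = refl
    ...   | false = refl

    fewer-tight-partners : ∀ {b₀} → tight b₀ ≡ true → unmatchedᵇ M b₀ ≡ true →
      count (matchedTo tight ∘ M) < count tight
    fewer-tight-partners {b₀} t₀ free = count-<-injection _ tight partner into injective b₀ t₀ miss
      where
      partner : Fin n → Fin n
      partner a = fromMaybe a (M a)
      into : ∀ a → matchedTo tight (M a) ≡ true → tight (partner a) ≡ true
      into a q with M a
      ... | just c = q
      injective : InjectiveOn (matchedTo tight ∘ M) partner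
      injective a a′ _ _ with M a in Ma | M a′ in Ma′
      ... | just c | just c′ = λ c≡c′ → M-injective Ma (trans Ma′ (cong just (sym c≡c′)))
      miss : ∀ a → matchedTo tight (M a) ≡ true → partner a ≢ b₀
      miss a _ with M a in Ma
      ... | just c = λ c≡b₀ → unmatched⁻ M free a (trans Ma (cong just c≡b₀))

    N-larger : ∀ {b₀} → tight b₀ ≡ true → unmatchedᵇ M b₀ ≡ true → size M < size N
    N-larger t₀ free = begin-strict
      size M                                          ≡⟨ size≡count M ⟩
      count (is-just ∘ M)                             ≡⟨ sum-cong-≗ (is-just-split tight ∘ M) ⟩
      sum (λ a → boolToℕ (matchedTo tight (M a)) + kept a)  ≡⟨ ∑-distrib-+ _ kept ⟩
      count (matchedTo tight ∘ M) + sum kept          <⟨ +-monoˡ-< (sum kept) fewer ⟩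
      count tight + sum kept                          ≡⟨ cong (_+ sum kept) reindexed ⟨
      count (tight ∘ p) + sum kept                    ≡⟨ ∑-distrib-+ (boolToℕ ∘ tight ∘ p) kept ⟨
      sum (λ a → boolToℕ (tight (p a)) + kept a)      ≡⟨ sum-cong-≗ N-count ⟨
      count (is-just ∘ N)                             ≡⟨ size≡count N ⟨
      size N                                          ∎
      where
      open ≤-Reasoning
      kept : Fin n → ℕ
      kept a = boolToℕ (matchedTo (not ∘ tight) (M a))
      fewer : count (matchedTo tight ∘ M) < count tight
      fewer = fewer-tight-partners t₀ free
      reindexed : count (tight ∘ p) ≡ count tight
      reindexed = ∑-reindex p-injective (boolToℕ ∘ tight)

    unmatched-below-dual : ∀ b → unmatchedᵇ M b ≡ true → ℓ b < d b
    unmatched-below-dual b free = ≤∧≢⇒< (ℓ≤d b) λ ℓb≡db →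
      <⇒≱ (N-larger (≡ᵇ-true⁺ ℓb≡db) free) (proj₂ maximum N N-matching)

  module _ (mm : MaxMatchingOracle n) (d<n : ∀ b → d b < n) where

    private
      gap : (Fin n → ℕ) → ℕ
      gap ℓ = sum (λ b → d b ∸ ℓ b)

      below-dual : ∀ ℓ → (∀ b → ℓ b ≤ d b) → ∀ b → unmatchedᵇ (oracle E pref F mm ℓ) b ≡ true →
        ℓ b < d b
      below-dual ℓ ℓ≤d = unmatched-below-dual ℓ ℓ≤d (proj₂ (mm (minusF (Gℓ E pref ℓ) F)))

    -- Every round raises only unmatched items, which stay below d, and lowers the gap to d.
    loop-succeeds : ∀ k ℓ → (∀ b → ℓ b ≤ d b) → gap ℓ < k → ∃ λ M → loop E pref F mm k ℓ ≡ just M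
    loop-succeeds (suc k) ℓ ℓ≤d gap<k
      rewrite allB⁺ {p = λ b → ℓ b <ᵇ n}
                    (λ b → Equivalence.to T-≡ (<⇒<ᵇ (≤-<-trans (ℓ≤d b) (d<n b))))
      with perfectᵇ (oracle E pref F mm ℓ) in perfect
    ... | true = _ , refl
    ... | false = loop-succeeds k ℓ′ ℓ′≤d (<-≤-trans gap-shrinks (s≤s⁻¹ gap<k))
      where
      M : Matching n
      M = oracle E pref F mm ℓ
      ℓ′ : Fin n → ℕ
      ℓ′ b = if unmatchedᵇ M b then suc (ℓ b) else ℓ b
      ℓ′≤d : ∀ b → ℓ′ b ≤ d b
      ℓ′≤d b with unmatchedᵇ M b in free
      ... | true = below-dual ℓ ℓ≤d b free
      ... | false = ℓ≤d b
      ℓ≤ℓ′ : ∀ b → ℓ b ≤ ℓ′ b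
      ℓ≤ℓ′ b with unmatchedᵇ M b
      ... | true = n≤1+n (ℓ b)
      ... | false = ≤-refl
      gap-shrinks : gap ℓ′ < gap ℓ
      gap-shrinks with b₀ , free ← unmatched-item M perfect =
        ∑-mono-< (λ b → ∸-monoʳ-≤ (d b) (ℓ≤ℓ′ b)) b₀ shrinks
        where
        shrinks : d b₀ ∸ ℓ′ b₀ < d b₀ ∸ ℓ b₀
        shrinks rewrite free = ∸-monoʳ-< (n<1+n (ℓ b₀)) (below-dual ℓ ℓ≤d b₀ free)

    algorithm2-complete : ∃ λ M → algorithm2 E pref F mm ≡ just M
    algorithm2-complete = loop-succeeds (suc (n * n)) (λ _ → 0) (λ _ → z≤n)
      (s≤s (∑-≤-const (λ b → <⇒≤ (d<n b))))

-- Levels under which a popular assignment is optimal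

module _ {n} {E : EdgeSet n} {pref : Prefs n} {P : Matching n} (perfectP : IsPerfectMatchingOf E P)
  where

  open Perfect perfectP
    renaming (mate to p; M≡mate to P≡p; mate-injective to p-injective; mate-edge to p-edge)

  -- Each agent x moves from p x to p (ρ x); a potential ψ rising weakly along every move and
  -- strictly along one would make the rotated matching beat P.
  popular⇒no-improving-rotation : IsPopular E pref P →
    (ρ : Fin n → Fin n) → Injective ρ → (∀ x → E x (p (ρ x)) ≡ true) → (ψ : Fin n → ℕ) →
    (∀ x → ψ x + boolToℕ (pref x (p x) (p (ρ x))) ≤ ψ (ρ x) + boolToℕ (pref x (p (ρ x)) (p x))) →
    ∀ x → ¬ (ψ x + boolToℕ (pref x (p x) (p (ρ x))) < ψ (ρ x) + boolToℕ (pref x (p (ρ x)) (p x)))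
  popular⇒no-improving-rotation (_ , popular) ρ ρ-injective moves ψ weak x strict =
    <⇒≱ (∑-<-by-potential (λ _ _ → id) ρ-injective ψ _ _ weak x strict)
        (subst₂ _≤_ (countPrefer-assignments pref (λ _ → refl) P≡p)
                    (countPrefer-assignments pref P≡p (λ _ → refl))
                    (popular N perfectN))
    where
    N : Matching n
    N x = just (p (ρ x))
    perfectN : IsPerfectMatchingOf E N
    perfectN = ( (λ x b Nx≡b → subst (λ b → E x b ≡ true) (just-injective Nx≡b) (moves x))
               , (λ x y b Nx≡b Ny≡b →
                    ρ-injective x y (p-injective _ _ (just-injective (trans Nx≡b (sym Ny≡b))))) )
               , λ _ → refl

  -- The least level of p x at which b, of level v, does not beat p x in Optimal (see gain-≤⁻).
  gain : Fin n → Fin n → ℕ → ℕ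
  gain x b v = v + boolToℕ (pref x b (p x)) ∸ boolToℕ (pref x (p x) b)

  gain-≤⁻ : ∀ {x b v w} → gain x b v ≤ w →
    v + boolToℕ (pref x b (p x)) ≤ w + boolToℕ (pref x (p x) b)
  gain-≤⁻ {x} {b} {v} {w} le = begin
    v + boolToℕ (pref x b (p x))           ≤⟨ m≤n+m∸n _ (boolToℕ (pref x (p x) b)) ⟩
    boolToℕ (pref x (p x) b) + gain x b v  ≤⟨ +-monoʳ-≤ _ le ⟩
    boolToℕ (pref x (p x) b) + w           ≡⟨ +-comm _ w ⟩
    w + boolToℕ (pref x (p x) b)           ∎
    where open ≤-Reasoning

  gain-mono : ∀ {x b v w} → v ≤ w → gain x b v ≤ gain x b w
  gain-mono {x} {b} le =
    ∸-monoˡ-≤ (boolToℕ (pref x (p x) b)) (+-monoˡ-≤ (boolToℕ (pref x b (p x))) le)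

  gain-≤-suc : ∀ x b v → gain x b v ≤ suc v
  gain-≤-suc x b v = begin
    gain x b v                    ≤⟨ m∸n≤m (v + boolToℕ (pref x b (p x))) (boolToℕ (pref x (p x) b)) ⟩
    v + boolToℕ (pref x b (p x))  ≤⟨ +-monoʳ-≤ v (bool≤1 (pref x b (p x))) ⟩
    v + 1                         ≡⟨ +-comm v 1 ⟩
    suc v                         ∎
    where
    open ≤-Reasoning
    bool≤1 : ∀ β → boolToℕ β ≤ 1
    bool≤1 true = ≤-refl
    bool≤1 false = z≤n

  -- When the gain is positive, the truncated subtraction in it is exact.
  gain-exact : ∀ x b v → 0 < gain x b v →
    gain x b v + boolToℕ (pref x (p x) b) ≡ v + boolToℕ (pref x b (p x))
  gain-exact x b v pos = m∸n+n≡m (<⇒≤ (m∸n≢0⇒n<m {v + boolToℕ (pref x b (p x))}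
                                                 {boolToℕ (pref x (p x) b)}
                                                 (λ eq → <-irrefl (sym eq) pos)))

  candidate : (Fin n → ℕ) → Fin n → Fin n → ℕ
  candidate δ x a = if E x (p a) then gain x (p a) (δ a) else 0

  relax : (Fin n → ℕ) → Fin n → ℕ
  relax δ x = δ x ⊔ maxOver (candidate δ x) (allFin n)

  iterate : ℕ → Fin n → ℕ
  iterate zero _ = 0
  iterate (suc k) = relax (iterate k)

  relax-≥ : ∀ δ x → δ x ≤ relax δ x
  relax-≥ δ x = m≤m⊔n _ _

  relax-≥-gain : ∀ δ {x a} → E x (p a) ≡ true → gain x (p a) (δ a) ≤ relax δ x
  relax-≥-gain δ {x} {a} e = ≤-trans
    (subst (_≤ _) (cong (λ β → if β then gain x (p a) (δ a) else 0) e)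
           (≤-maxOver (candidate δ x) (∈-allFin a)))
    (m≤n⊔m _ _)

  relax-attained : ∀ δ x → δ x < relax δ x →
    ∃ λ a → E x (p a) ≡ true × relax δ x ≡ gain x (p a) (δ a)
  relax-attained δ x grows with ⊔-sel (δ x) (maxOver (candidate δ x) (allFin n))
  ... | inj₁ stays = contradiction (sym stays) (<⇒≢ grows)
  ... | inj₂ isMax with maxOver-attained (candidate δ x) (allFin n)
  ...   | inj₁ isZero = contradiction (≤-trans grows (≤-reflexive (trans isMax isZero))) λ ()
  ...   | inj₂ (a , _ , attained) with E x (p a) in e
  ...     | true = a , e , trans isMax (sym attained)
  ...     | false = contradiction (≤-trans grows (≤-reflexive (trans isMax (sym attained)))) λ ()

  iterate-≤ : ∀ k x → iterate k x ≤ k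
  iterate-≤ zero x = z≤n
  iterate-≤ (suc k) x =
    ⊔-lub (≤-trans (iterate-≤ k x) (n≤1+n k))
          (maxOver-lub (candidate (iterate k) x) {allFin n} λ {a} _ → bound a)
    where
    bound : ∀ a → candidate (iterate k) x a ≤ suc k
    bound a with E x (p a)
    ... | true = ≤-trans (gain-≤-suc x (p a) (iterate k a)) (s≤s (iterate-≤ k a))
    ... | false = z≤n

  iterate-mono : ∀ {k l} x → k ≤ l → iterate k x ≤ iterate l x
  iterate-mono x k≤l = go (≤⇒≤′ k≤l)
    where
    go : ∀ {k l} → k ≤′ l → iterate k x ≤ iterate l x
    go ≤′-refl = ≤-refl
    go (≤′-step k≤′l) = ≤-trans (go k≤′l) (relax-≥ _ x)

  Ascent : (ℕ → Fin n) → ℕ → Set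
  Ascent c j = E (c (suc j)) (p (c j)) ≡ true
             × iterate (suc j) (c (suc j)) ≡ gain (c (suc j)) (p (c j)) (iterate j (c j))
             × iterate j (c (suc j)) < iterate (suc j) (c (suc j))

  private
    extend : (ℕ → Fin n) → ℕ → Fin n → ℕ → Fin n
    extend c k x j with j ≟ k
    ... | yes _ = x
    ... | no _ = c j

    extend-at : ∀ c k x → extend c k x k ≡ x
    extend-at c k x with k ≟ k
    ... | yes _ = refl
    ... | no k≢k = contradiction refl k≢k

    extend-below : ∀ c k x {j} → j < k → extend c k x j ≡ c j
    extend-below c k x {j} j<k with j ≟ k
    ... | yes refl = contradiction j<k (<-irrefl refl)
    ... | no _ = refl

    Ascent-cong : ∀ {c c′ j} → c j ≡ c′ j → c (suc j) ≡ c′ (suc j) → Ascent c′ j → Ascent c j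
    Ascent-cong eq eq′ ascent rewrite eq | eq′ = ascent

  rise-propagates : ∀ {L x a} → iterate (suc L) x < iterate (2 + L) x → E x (p a) ≡ true →
    iterate (2 + L) x ≡ gain x (p a) (iterate (suc L) a) → iterate L a < iterate (suc L) a
  rise-propagates {L} {x} {a} rises e attained = ≰⇒> λ stalls → <⇒≱ rises (begin
    iterate (2 + L) x                 ≡⟨ attained ⟩
    gain x (p a) (iterate (suc L) a)  ≤⟨ gain-mono stalls ⟩
    gain x (p a) (iterate L a)        ≤⟨ relax-≥-gain (iterate L) e ⟩
    iterate (suc L) x                 ∎)
    where open ≤-Reasoning

  ascent-to : ∀ L x → iterate L x < iterate (suc L) x →
    ∃ λ c → c (suc L) ≡ x × (∀ j → j < suc L → Ascent c j)
  ascent-to zero x rises with a , e , attained ← relax-attained (iterate 0) x rises =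
    extend (λ _ → a) 1 x , refl , λ { zero _ → e , attained , rises ; (suc j) (s≤s ()) }
  ascent-to (suc L) x rises with a , e , attained ← relax-attained (iterate (suc L)) x rises
    with c , c-end , ascents ← ascent-to L a (rise-propagates {L} {x} {a} rises e attained) =
    extend c (2 + L) x , extend-at c (2 + L) x , ascents′
    where
    ascents′ : ∀ j → j < 2 + L → Ascent (extend c (2 + L) x) j
    ascents′ j j<2+L with m≤n⇒m<n∨m≡n (s≤s⁻¹ j<2+L)
    ... | inj₁ j<1+L = Ascent-cong {extend c (2 + L) x} {c} {j}
      (extend-below c (2 + L) x (<-trans j<1+L (n<1+n _))) (extend-below c (2 + L) x (s≤s j<1+L))
      (ascents j j<1+L)
    ... | inj₂ refl rewrite extend-below c (2 + L) x (n<1+n _) | c-end | extend-at c (2 + L) x =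
      e , attained , rises

  -- Positions I < k ≤ suc J of c form a cycle (c I ≡ c (suc J)); moving each agent on it to
  -- the item of its predecessor, with potential ψ read off the ascent, is a strictly improving
  -- rotation.
  module Cycle (c : ℕ → Fin n) {I J : ℕ} (I≤J : I ≤ J) (closes : c I ≡ c (suc J))
               (distinct : ∀ {i j} → i < j → j ≤ J → c i ≢ c j) (ascents : ∀ j → j ≤ J → Ascent c j)
    where

    OnCycle : Fin n → Set
    OnCycle x = ∃ λ k → k < 2 + J × I < k × c k ≡ x

    on-cycle? : ∀ x → Dec (OnCycle x)
    on-cycle? x = anyUpTo? (λ k → (I <? k) ×-dec (c k ≟ᶠ x)) (2 + J)

    separate : ∀ {i j} → i < j → I < i → j ≤ suc J → c i ≢ c j
    separate {i} {j} i<j I<i j≤1+J with m≤n⇒m<n∨m≡n j≤1+J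
    ... | inj₁ j<1+J = distinct i<j (s≤s⁻¹ j<1+J)
    ... | inj₂ refl = λ ci≡c1+J → distinct I<i (s≤s⁻¹ i<j) (trans closes (sym ci≡c1+J))

    position-unique : ∀ {k k′} → k < 2 + J → I < k → k′ < 2 + J → I < k′ → c k ≡ c k′ → k ≡ k′
    position-unique {k} {k′} k≤1+J I<k k′≤1+J I<k′ eq with <-cmp k k′
    ... | tri≈ _ k≡k′ _ = k≡k′
    ... | tri< k<k′ _ _ = contradiction eq (separate k<k′ I<k (s≤s⁻¹ k′≤1+J))
    ... | tri> _ _ k′<k = contradiction (sym eq) (separate k′<k I<k′ (s≤s⁻¹ k≤1+J))

    positions-injective : ∀ {i j} → i ≤ J → j ≤ J → c i ≡ c j → i ≡ j
    positions-injective {i} {j} i≤J j≤J eq with <-cmp i j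
    ... | tri≈ _ i≡j _ = i≡j
    ... | tri< i<j _ _ = contradiction eq (distinct i<j j≤J)
    ... | tri> _ _ j<i = contradiction (sym eq) (distinct j<i i≤J)

    ρ : Fin n → Fin n
    ρ x with on-cycle? x
    ... | yes (k , _) = c (pred k)
    ... | no _ = x

    ψ : Fin n → ℕ
    ψ x with on-cycle? x
    ... | yes (k , _) = iterate k x
    ... | no _ = 0

    at-position : ∀ {x k} → k < 2 + J → I < k → c k ≡ x → ρ x ≡ c (pred k) × ψ x ≡ iterate k x
    at-position {x} k≤1+J I<k ck≡x with on-cycle? x
    ... | yes (k′ , k′≤1+J , I<k′ , ck′≡x)
      rewrite position-unique k′≤1+J I<k′ k≤1+J I<k (trans ck′≡x (sym ck≡x)) = refl , refl
    ... | no off = contradiction (_ , k≤1+J , I<k , ck≡x) off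

    off-cycle : ∀ {x} → ¬ OnCycle x → ρ x ≡ x × ψ x ≡ 0
    off-cycle {x} off with on-cycle? x
    ... | yes on = contradiction on off
    ... | no _ = refl , refl

    on-cycle-at : ∀ {j} → I ≤ j → j ≤ J → OnCycle (c j)
    on-cycle-at {j} I≤j j≤J with m≤n⇒m<n∨m≡n I≤j
    ... | inj₁ I<j = j , s≤s (m≤n⇒m≤1+n j≤J) , I<j , refl
    ... | inj₂ refl = suc J , ≤-refl , s≤s I≤J , sym closes

    ρ-injective : Injective ρ
    ρ-injective x y eq with on-cycle? x | on-cycle? y
    ... | yes (suc k , k≤1+J , s≤s I≤k , refl) | yes (suc k′ , k′≤1+J , s≤s I≤k′ , refl) =
      cong (c ∘ suc) (positions-injective (s≤s⁻¹ (s≤s⁻¹ k≤1+J)) (s≤s⁻¹ (s≤s⁻¹ k′≤1+J)) eq)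
    ... | yes (suc k , k≤1+J , s≤s I≤k , refl) | no off =
      contradiction (subst OnCycle eq (on-cycle-at I≤k (s≤s⁻¹ (s≤s⁻¹ k≤1+J)))) off
    ... | no off | yes (suc k′ , k′≤1+J , s≤s I≤k′ , refl) =
      contradiction (subst OnCycle (sym eq) (on-cycle-at I≤k′ (s≤s⁻¹ (s≤s⁻¹ k′≤1+J)))) off
    ... | no _ | no _ = eq

    ρ-edge : ∀ x → E x (p (ρ x)) ≡ true
    ρ-edge x with on-cycle? x
    ... | yes (suc k , k≤1+J , s≤s I≤k , refl) = proj₁ (ascents k (s≤s⁻¹ (s≤s⁻¹ k≤1+J)))
    ... | no _ = p-edge x

    step-exact : ∀ {k} → k ≤ J → let x = c (suc k) in
      iterate (suc k) x + boolToℕ (pref x (p x) (p (c k)))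
        ≡ iterate k (c k) + boolToℕ (pref x (p (c k)) (p x))
    step-exact {k} k≤J with _ , attained , rises ← ascents k k≤J =
      trans (cong (_+ boolToℕ (pref (c (suc k)) (p (c (suc k))) (p (c k)))) attained)
            (gain-exact (c (suc k)) (p (c k)) (iterate k (c k))
                        (subst (0 <_) attained (≤-<-trans z≤n rises)))

    ψ-start : iterate I (c I) < ψ (c I)
    ψ-start = begin-strict
      iterate I (c I)              ≤⟨ iterate-mono (c I) I≤J ⟩
      iterate J (c I)              ≡⟨ cong (iterate J) closes ⟩
      iterate J (c (suc J))        <⟨ proj₂ (proj₂ (ascents J ≤-refl)) ⟩
      iterate (suc J) (c (suc J))  ≡⟨ cong (iterate (suc J)) closes ⟨
      iterate (suc J) (c I)        ≡⟨ proj₂ (at-position ≤-refl (s≤s I≤J) (sym closes)) ⟨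
      ψ (c I)                      ∎
      where open ≤-Reasoning

    ψ-predecessor : ∀ {j} → I ≤ j → j ≤ J → iterate j (c j) ≤ ψ (c j)
    ψ-predecessor I≤j j≤J with m≤n⇒m<n∨m≡n I≤j
    ... | inj₁ I<j = ≤-reflexive (sym (proj₂ (at-position (s≤s (m≤n⇒m≤1+n j≤J)) I<j refl)))
    ... | inj₂ refl = <⇒≤ ψ-start

    ψ-rises : ∀ x →
      ψ x + boolToℕ (pref x (p x) (p (ρ x))) ≤ ψ (ρ x) + boolToℕ (pref x (p (ρ x)) (p x))
    ψ-rises x = by-cases (on-cycle? x)
      where
      by-cases : Dec (OnCycle x) →
        ψ x + boolToℕ (pref x (p x) (p (ρ x))) ≤ ψ (ρ x) + boolToℕ (pref x (p (ρ x)) (p x))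
      by-cases (yes (suc k , k≤1+J , I<1+k@(s≤s I≤k) , refl))
        with ρx≡ck , ψx≡ ← at-position k≤1+J I<1+k refl
        rewrite ρx≡ck | ψx≡ with k≤J ← s≤s⁻¹ (s≤s⁻¹ k≤1+J) =
        ≤-trans (≤-reflexive (step-exact k≤J)) (+-monoˡ-≤ _ (ψ-predecessor I≤k k≤J))
      by-cases (no off) rewrite proj₁ (off-cycle off) = ≤-refl

    ψ-rises-strictly : let x = c (suc I) in
      ψ x + boolToℕ (pref x (p x) (p (ρ x))) < ψ (ρ x) + boolToℕ (pref x (p (ρ x)) (p x))
    ψ-rises-strictly with ρx≡cI , ψx≡ ← at-position (s≤s (s≤s I≤J)) ≤-refl refl
      rewrite ρx≡cI | ψx≡ = ≤-<-trans (≤-reflexive (step-exact I≤J)) (+-monoˡ-< _ ψ-start)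

    not-popular : ¬ IsPopular E pref P
    not-popular popular = popular⇒no-improving-rotation popular ρ ρ-injective ρ-edge ψ ψ-rises
                            (c (suc I)) ψ-rises-strictly

  module _ (popular : IsPopular E pref P) where

    -- Among positions 0 … n of the ascent some agent repeats; the first repetition closes a cycle.
    long-ascent-impossible : ∀ {L} (c : ℕ → Fin n) → (∀ j → j < suc L → Ascent c j) → n ≤ suc L → ⊥
    long-ascent-impossible {L} c ascents n≤1+L
      with i₀ , j₀ , i₀<j₀ , repeat ← pigeonhole (n<1+n n) (c ∘ toℕ)
      with suc J , J<j₀ , (I , s≤s I≤J , closes) , first ←
             least (λ k → anyUpTo? (λ i → c i ≟ᶠ c k) k) (toℕ i₀ , i₀<j₀ , repeat)
      = Cycle.not-popular c I≤J closes (λ i<j j≤J ci≡cj → first (s≤s j≤J) (_ , i<j , ci≡cj))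
          (λ j j≤J → ascents j (≤-trans (s≤s j≤J) (≤-trans J<j₀ (≤-trans (toℕ≤pred[n] j₀) n≤1+L))))
          popular

    stable : ∀ L → n ≤ suc L → ∀ x → iterate (suc L) x ≤ iterate L x
    stable L n≤1+L x = ≮⇒≥ λ rises →
      let c , _ , ascents = ascent-to L x rises in long-ascent-impossible c ascents n≤1+L

    private
      p⁻¹ : Fin n → Fin n
      p⁻¹ b = proj₁ (injective⇒surjective p-injective b)

      p∘p⁻¹ : ∀ b → p (p⁻¹ b) ≡ b
      p∘p⁻¹ b = proj₂ (injective⇒surjective p-injective b)

      m≤1+pred[m] : ∀ m → m ≤ suc (pred m)
      m≤1+pred[m] zero = z≤n
      m≤1+pred[m] (suc _) = ≤-refl

      pred[m]<m : ∀ {m} → Fin m → pred m < m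
      pred[m]<m {suc m} _ = ≤-refl

    dual : Fin n → ℕ
    dual b = iterate (pred n) (p⁻¹ b)

    dual-<n : ∀ b → dual b < n
    dual-<n b = ≤-<-trans (iterate-≤ (pred n) (p⁻¹ b)) (pred[m]<m b)

    dual-optimal : ∀ a → Optimal E pref dual a (p a)
    dual-optimal a b ab =
      subst₂ (λ b′ δa → dual b + boolToℕ (pref a b′ (p a)) ≤ δa + boolToℕ (pref a (p a) b′))
        (p∘p⁻¹ b) (cong (iterate (pred n)) (sym (p-injective _ _ (p∘p⁻¹ (p a)))))
        (gain-≤⁻ (≤-trans (relax-≥-gain (iterate (pred n)) {a} {p⁻¹ b} ab′)
                          (stable (pred n) (m≤1+pred[m] n) a)))
      where
      ab′ : E a (p (p⁻¹ b)) ≡ true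
      ab′ = subst (λ b → E a b ≡ true) (sym (p∘p⁻¹ b)) ab

theorem12 : (n : ℕ) (E : EdgeSet n) (pref : Prefs n) (F : EdgeSet n) →
    IsStrictPartialPrefs E pref → F ⊆ᴱ E → (mm : MaxMatchingOracle n) →
    ((M : Matching n) → algorithm2 E pref F mm ≡ just M →
       IsPopular E pref M × Avoids M F)
    × (Σ (Matching n) (λ P → IsPopular E pref P × Avoids P F) →
       Σ (Matching n) (λ M → algorithm2 E pref F mm ≡ just M))
theorem12 n E pref F po _ mm = algorithm2-sound E pref F mm po , complete
  where
  complete : Σ (Matching n) (λ P → IsPopular E pref P × Avoids P F) →
             Σ (Matching n) (λ M → algorithm2 E pref F mm ≡ just M)
  complete (P , popular@(perfect , _) , avoids) =
    Completeness.algorithm2-complete po perfect avoids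
      (dual perfect popular) (dual-optimal perfect popular) mm (dual-<n perfect popular)
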